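{- Let $G_1$ and $G_2$ be vertex-disjoint graphs, each with at least one vertex, and let $G_1\cup G_2$ be their disjoint union. Then $\operatorname{car}(G_1\cup G_2)=\max\{\operatorname{car}(G_1),\operatorname{car}(G_2)\}$.
   Context: All graphs are finite, simple and undirected; $G[X]$ denotes the subgraph induced by $X$. A set $S\subseteq V(G)$ is cycle convex if for every $u\in V(G)\setminus S$ the graph $G[S\cup\{u\}]$ contains no cycle passing through $u$. The cycle convex hull $\langle S\rangle$ is the smallest cycle convex set containing $S$. A set $S$ is Carathéodory independent if there is $p\in\langle S\rangle$ with $p\notin \bigcup_{a\in S}\langle S\setminus\{a\}\rangle$. The Carathéodory number $\operatorname{car}(G)$ is the maximum cardinality of a Carathéodory independent set of $G$. -}

module Defs where

open import Data.Nat using (ℕ; suc; _+_; _≤_)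
open import Data.Bool using (Bool; true; false; T)
open import Data.Fin using (Fin; splitAt)
open import Data.Fin.Subset using (Subset; _∈_; _∉_; _⊆_; _-_; ∣_∣)
open import Data.Sum using (_⊎_; inj₁; inj₂)
open import Data.Product using (Σ; ∃; _×_; _,_)
open import Data.List using (List; []; _∷_; length)
open import Data.List.Relation.Unary.All using (All)
open import Data.List.Relation.Unary.Unique.Propositional using (Unique)
open import Relation.Binary.PropositionalEquality using (_≡_; refl)
open import Relation.Nullary using (¬_)
open import Data.Unit using (⊤)

record Graph : Set where
  field
    n      : ℕ
    adj    : Fin n → Fin n → Bool
    sym    : ∀ u v → adj u v ≡ adj v u
    irrefl : ∀ v → adj v v ≡ false

open Graph public

-- Disjoint union: vertices of G₁ are the first n G₁ elements of Fin (n G₁ + n G₂).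
⊎adj : ∀ {m k} → (Fin m → Fin m → Bool) → (Fin k → Fin k → Bool) →
       Fin m ⊎ Fin k → Fin m ⊎ Fin k → Bool
⊎adj a b (inj₁ x) (inj₁ y) = a x y
⊎adj a b (inj₂ x) (inj₂ y) = b x y
⊎adj a b (inj₁ x) (inj₂ y) = false
⊎adj a b (inj₂ x) (inj₁ y) = false

⊎adj-sym : ∀ {m k} (a : Fin m → Fin m → Bool) (b : Fin k → Fin k → Bool) →
           (∀ u v → a u v ≡ a v u) → (∀ u v → b u v ≡ b v u) →
           ∀ x y → ⊎adj a b x y ≡ ⊎adj a b y x
⊎adj-sym a b sa sb (inj₁ x) (inj₁ y) = sa x y
⊎adj-sym a b sa sb (inj₂ x) (inj₂ y) = sb x y
⊎adj-sym a b sa sb (inj₁ x) (inj₂ y) = refl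
⊎adj-sym a b sa sb (inj₂ x) (inj₁ y) = refl

⊎adj-irrefl : ∀ {m k} (a : Fin m → Fin m → Bool) (b : Fin k → Fin k → Bool) →
              (∀ v → a v v ≡ false) → (∀ v → b v v ≡ false) →
              ∀ x → ⊎adj a b x x ≡ false
⊎adj-irrefl a b ia ib (inj₁ x) = ia x
⊎adj-irrefl a b ia ib (inj₂ x) = ib x

_∪G_ : Graph → Graph → Graph
G₁ ∪G G₂ = record
  { n      = n G₁ + n G₂
  ; adj    = λ u v → ⊎adj (adj G₁) (adj G₂) (splitAt (n G₁) u) (splitAt (n G₁) v)
  ; sym    = λ u v → ⊎adj-sym (adj G₁) (adj G₂) (sym G₁) (sym G₂)
                       (splitAt (n G₁) u) (splitAt (n G₁) v)
  ; irrefl = λ v → ⊎adj-irrefl (adj G₁) (adj G₂) (irrefl G₁) (irrefl G₂)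
                       (splitAt (n G₁) v)
  }

module _ (G : Graph) where

  Adj : Fin (n G) → Fin (n G) → Set
  Adj u v = T (adj G u v)

  Consecutive : List (Fin (n G)) → Set
  Consecutive []             = ⊤
  Consecutive (x ∷ [])       = ⊤
  Consecutive (x ∷ y ∷ rest) = Adj x y × Consecutive (y ∷ rest)

  lastOr : Fin (n G) → List (Fin (n G)) → Fin (n G)
  lastOr d []       = d
  lastOr d (x ∷ xs) = lastOr x xs

  CycleThrough : Subset (n G) → Fin (n G) → Set
  CycleThrough S u =
    Σ (List (Fin (n G))) λ rest →
      (2 ≤ length rest) ×
      Unique (u ∷ rest) ×
      All (λ v → v ∈ S ⊎ v ≡ u) (u ∷ rest) ×
      Consecutive (u ∷ rest) ×
      Adj (lastOr u rest) u

  CycleConvex : Subset (n G) → Set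
  CycleConvex S = ∀ u → u ∉ S → ¬ CycleThrough S u

  InHull : Subset (n G) → Fin (n G) → Set
  InHull S p = ∀ T → S ⊆ T → CycleConvex T → p ∈ T

  CaratheodoryIndependent : Subset (n G) → Set
  CaratheodoryIndependent S =
    ∃ λ p → InHull S p × (∀ a → a ∈ S → ¬ InHull (S - a) p)

  IsCar : ℕ → Set
  IsCar k = (∃ λ S → CaratheodoryIndependent S × ∣ S ∣ ≡ k)
          × (∀ S → CaratheodoryIndependent S → ∣ S ∣ ≤ k)

-- Each side of a disjoint union is a union of components, so a cycle of the
-- union through a vertex stays on that vertex's side. Hence cycle convex hulls
-- are computed side by side: for a vertex i of G₁, i ∈ ⟨S⟩ iff i ∈ ⟨S ∩ V(G₁)⟩
-- computed in G₁. A Carathéodory independent set of Gᵢ therefore stays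
-- independent in the union, and conversely an independent set S of the union
-- with witness p on side i lies entirely on side i: a vertex a of S on the
-- other side could be dropped without changing the hull at p. So the
-- independent sets of the union are exactly those of G₁ and those of G₂.

module Submission where

open import Defs hiding (sym)
open import Data.Nat using (ℕ; _≤_; _⊔_; _+_; suc)
import Data.Nat.Properties as ℕ
open import Data.Bool using (Bool; true; false; T)
open import Data.Maybe using (Maybe; just; nothing; maybe)
open import Data.Maybe.Properties using (just-injective)
open import Data.Fin using (Fin; splitAt; _↑ˡ_; _↑ʳ_)
open import Data.Fin.Properties using (splitAt-↑ˡ; splitAt-↑ʳ; splitAt⁻¹-↑ˡ; splitAt⁻¹-↑ʳ)
open import Data.Fin.Subset using (Subset; _∈_; _∉_; _⊆_; _-_; _─_; ∣_∣; ⁅_⁆; inside; outside) renaming (⊥ to ∅)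
open import Data.Fin.Subset.Properties using (p─q⊆p; x∈p∧x≢y⇒x∈p-y; x∉⁅y⁆⇒x≢y; ∣⊥∣≡0)
open import Data.Vec using ([]; _∷_; lookup; tabulate; _++_; here; there)
open import Data.Vec.Properties using (lookup∘tabulate; tabulate∘lookup; tabulate-cong; lookup-splitAt; lookup-replicate; []=⇒lookup; lookup⇒[]=)
open import Data.Sum using (_⊎_; inj₁; inj₂; [_,_]′)
open import Data.Product using (∃; _×_; _,_; proj₁; proj₂)
import Data.List as List
import Data.List.Relation.Unary.All as All
import Data.List.Relation.Unary.All.Properties as All
open import Data.List.Properties using (length-map)
import Data.List.Relation.Unary.Unique.Propositional.Properties as Unique
open import Data.Empty using (⊥-elim)
open import Data.Unit using (tt)
open import Function using (_∘_; const)
open import Relation.Binary.PropositionalEquality using (_≡_; _≢_; refl; sym; trans; cong; cong₂; subst; module ≡-Reasoning)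
open import Relation.Nullary using (¬_)

∈-tabulate⁺ : ∀ {m} {h : Fin m → Bool} {x} → h x ≡ true → x ∈ tabulate h
∈-tabulate⁺ {h = h} {x} hx = lookup⇒[]= x _ (trans (lookup∘tabulate h x) hx)

∈-tabulate⁻ : ∀ {m} (h : Fin m → Bool) {x} → x ∈ tabulate h → h x ≡ true
∈-tabulate⁻ h {x} x∈ = trans (sym (lookup∘tabulate h x)) ([]=⇒lookup x∈)

x∈p─q⇒x∉q : ∀ {m} {x : Fin m} (p q : Subset m) → x ∈ p ─ q → x ∉ q
x∈p─q⇒x∉q (inside ∷ p) (outside ∷ q) here      ()
x∈p─q⇒x∉q (_ ∷ p)      (_ ∷ q)       (there x∈) (there x∈q) = x∈p─q⇒x∉q p q x∈ x∈q

x∈p-y⇒x≢y : ∀ {m} {x y : Fin m} (p : Subset m) → x ∈ p - y → x ≢ y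
x∈p-y⇒x≢y {y = y} p x∈ = x∉⁅y⁆⇒x≢y (x∈p─q⇒x∉q p ⁅ y ⁆ x∈)

p⊆q⇒p-x⊆q-x : ∀ {m} {p q : Subset m} {x} → p ⊆ q → p - x ⊆ q - x
p⊆q⇒p-x⊆q-x {p = p} {x = x} p⊆q y∈ =
  x∈p∧x≢y⇒x∈p-y (p⊆q (p─q⊆p p ⁅ x ⁆ y∈)) (x∈p-y⇒x≢y p y∈)

∣p++q∣≡∣p∣+∣q∣ : ∀ {a b} (p : Subset a) (q : Subset b) → ∣ p ++ q ∣ ≡ ∣ p ∣ + ∣ q ∣
∣p++q∣≡∣p∣+∣q∣ []          q = refl
∣p++q∣≡∣p∣+∣q∣ (true ∷ p)  q = cong suc (∣p++q∣≡∣p∣+∣q∣ p q)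
∣p++q∣≡∣p∣+∣q∣ (false ∷ p) q = ∣p++q∣≡∣p∣+∣q∣ p q

∣p++∅∣≡∣p∣ : ∀ {a b} (p : Subset a) → ∣ p ++ ∅ {b} ∣ ≡ ∣ p ∣
∣p++∅∣≡∣p∣ {b = b} p = begin
  ∣ p ++ ∅ ∣         ≡⟨ ∣p++q∣≡∣p∣+∣q∣ p ∅ ⟩
  ∣ p ∣ + ∣ ∅ {b} ∣   ≡⟨ cong (∣ p ∣ +_) (∣⊥∣≡0 b) ⟩
  ∣ p ∣ + 0           ≡⟨ ℕ.+-identityʳ _ ⟩
  ∣ p ∣               ∎
  where open ≡-Reasoning

∣∅++p∣≡∣p∣ : ∀ {a b} (p : Subset b) → ∣ ∅ {a} ++ p ∣ ≡ ∣ p ∣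
∣∅++p∣≡∣p∣ {a} p = trans (∣p++q∣≡∣p∣+∣q∣ (∅ {a}) p) (cong (_+ ∣ p ∣) (∣⊥∣≡0 a))

module _ (G : Graph) where

  InHull-mono : ∀ {S S′ p} → S ⊆ S′ → InHull G S p → InHull G S′ p
  InHull-mono S⊆S′ p∈⟨S⟩ C S′⊆C = p∈⟨S⟩ C (S′⊆C ∘ S⊆S′)

  CaratheodoryWitness : Subset (n G) → Fin (n G) → Set
  CaratheodoryWitness S p = InHull G S p × (∀ a → a ∈ S → ¬ InHull G (S - a) p)

-- The range of embed is a union of connected components of G.
record ComponentEmbedding (H G : Graph) : Set where
  field
    embed         : Fin (n H) → Fin (n G)
    project       : Fin (n G) → Maybe (Fin (n H))
    project-embed : ∀ i → project (embed i) ≡ just i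
    embed-project : ∀ {v i} → project v ≡ just i → embed i ≡ v
    adj-embed     : ∀ x y → adj G (embed x) (embed y) ≡ adj H x y
    adj-closed    : ∀ x v → Adj G (embed x) v → ∃ λ y → embed y ≡ v

module _ {H G : Graph} (E : ComponentEmbedding H G) where
  open ComponentEmbedding E

  embed-injective : ∀ {x y} → embed x ≡ embed y → x ≡ y
  embed-injective {x} {y} eq = just-injective (begin
    just x            ≡⟨ sym (project-embed x) ⟩
    project (embed x) ≡⟨ cong project eq ⟩
    project (embed y) ≡⟨ project-embed y ⟩
    just y            ∎)
    where open ≡-Reasoning

  project-outside : ∀ {v} → project v ≡ nothing → ∀ i → embed i ≢ v
  project-outside {v} eq i refl with () ← trans (sym (project-embed i)) eq

  Consecutive-map⁺ : ∀ xs → Consecutive H xs → Consecutive G (List.map embed xs)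
  Consecutive-map⁺ List.[]                   _         = tt
  Consecutive-map⁺ (x List.∷ List.[])        _         = tt
  Consecutive-map⁺ (x List.∷ y List.∷ rest) (x~y , c) =
    subst T (sym (adj-embed x y)) x~y , Consecutive-map⁺ (y List.∷ rest) c

  Consecutive-map⁻ : ∀ xs → Consecutive G (List.map embed xs) → Consecutive H xs
  Consecutive-map⁻ List.[]                   _         = tt
  Consecutive-map⁻ (x List.∷ List.[])        _         = tt
  Consecutive-map⁻ (x List.∷ y List.∷ rest) (x~y , c) =
    subst T (adj-embed x y) x~y , Consecutive-map⁻ (y List.∷ rest) c

  lastOr-map : ∀ d xs → lastOr G (embed d) (List.map embed xs) ≡ embed (lastOr H d xs)
  lastOr-map d List.[]        = refl
  lastOr-map d (x List.∷ xs) = lastOr-map x xs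

  walk-in-range : ∀ x rest → Consecutive G (embed x List.∷ rest) →
                  ∃ λ rest′ → List.map embed rest′ ≡ rest
  walk-in-range x List.[]         _            = List.[] , refl
  walk-in-range x (v List.∷ rest) (x~v , walk) with adj-closed x v x~v
  ... | y , refl with walk-in-range y rest walk
  ...   | rest′ , refl = y List.∷ rest′ , refl

  CycleThrough-embed : ∀ {S S′ u} → (∀ {v} → v ∈ S → embed v ∈ S′) →
                       CycleThrough H S u → CycleThrough G S′ (embed u)
  CycleThrough-embed {u = u} S→S′ (rest , long , unique , members , walk , closing) =
    List.map embed rest ,
    subst (2 ≤_) (sym (length-map embed rest)) long ,
    Unique.map⁺ embed-injective unique ,
    All.map⁺ (All.map member members) ,
    Consecutive-map⁺ (u List.∷ rest) walk ,
    subst (λ w → Adj G w (embed u)) (sym (lastOr-map u rest))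
          (subst T (sym (adj-embed _ u)) closing)
    where
    member : ∀ {v} → v ∈ _ ⊎ v ≡ u → embed v ∈ _ ⊎ embed v ≡ embed u
    member (inj₁ v∈S) = inj₁ (S→S′ v∈S)
    member (inj₂ refl) = inj₂ refl

  CycleThrough-unembed : ∀ {S S′ u} → (∀ {v} → embed v ∈ S′ → v ∈ S) →
                         CycleThrough G S′ (embed u) → CycleThrough H S u
  CycleThrough-unembed {u = u} S′→S (rest , long , unique , members , walk , closing)
    with walk-in-range u rest walk
  ... | rest′ , refl =
    rest′ ,
    subst (2 ≤_) (length-map embed rest′) long ,
    Unique.map⁻ unique ,
    All.map member (All.map⁻ members) ,
    Consecutive-map⁻ (u List.∷ rest′) walk ,
    subst T (adj-embed _ u) (subst (λ w → Adj G w (embed u)) (lastOr-map u rest′) closing)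
    where
    member : ∀ {v} → embed v ∈ _ ⊎ embed v ≡ embed u → v ∈ _ ⊎ v ≡ u
    member (inj₁ v∈S′) = inj₁ (S′→S v∈S′)
    member (inj₂ eq)  = inj₂ (embed-injective eq)

  preimage : Subset (n G) → Subset (n H)
  preimage S = tabulate (lookup S ∘ embed)

  extend : Bool → Subset (n H) → Subset (n G)
  extend d S = tabulate (maybe (lookup S) d ∘ project)

  ∈-preimage⁺ : ∀ {S i} → embed i ∈ S → i ∈ preimage S
  ∈-preimage⁺ i∈ = ∈-tabulate⁺ ([]=⇒lookup i∈)

  ∈-preimage⁻ : ∀ S {i} → i ∈ preimage S → embed i ∈ S
  ∈-preimage⁻ S {i} i∈ = lookup⇒[]= (embed i) S (∈-tabulate⁻ (lookup S ∘ embed) i∈)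

  ∈-extend⁺ : ∀ {d S i} → i ∈ S → embed i ∈ extend d S
  ∈-extend⁺ {d} {S} {i} i∈ =
    ∈-tabulate⁺ (trans (cong (maybe (lookup S) d) (project-embed i)) ([]=⇒lookup i∈))

  ∈-extend⁻ : ∀ d S {i} → embed i ∈ extend d S → i ∈ S
  ∈-extend⁻ d S {i} i∈ = lookup⇒[]= i S (trans
    (cong (maybe (lookup S) d) (sym (project-embed i)))
    (∈-tabulate⁻ (maybe (lookup S) d ∘ project) i∈))

  ∈-extend-outside : ∀ S {v} → project v ≡ nothing → v ∈ extend true S
  ∈-extend-outside S eq = ∈-tabulate⁺ (cong (maybe (lookup S) true) eq)

  preimage-─⁺ : ∀ S {a i} → i ∈ preimage S - a → i ∈ preimage (S - embed a)
  preimage-─⁺ S {a} i∈ = ∈-preimage⁺ (x∈p∧x≢y⇒x∈p-y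
    (∈-preimage⁻ S (p─q⊆p (preimage S) ⁅ a ⁆ i∈)) (x∈p-y⇒x≢y (preimage S) i∈ ∘ embed-injective))

  preimage-─⁻ : ∀ S {a i} → i ∈ preimage (S - embed a) → i ∈ preimage S - a
  preimage-─⁻ S {a} i∈ = x∈p∧x≢y⇒x∈p-y
    (∈-preimage⁺ (p─q⊆p S ⁅ embed a ⁆ (∈-preimage⁻ (S - embed a) i∈)))
    (x∈p-y⇒x≢y S (∈-preimage⁻ (S - embed a) i∈) ∘ cong embed)

  preimage-─-outside : ∀ S {v i} → project v ≡ nothing → i ∈ preimage S → i ∈ preimage (S - v)
  preimage-─-outside S {i = i} eq i∈ =
    ∈-preimage⁺ (x∈p∧x≢y⇒x∈p-y (∈-preimage⁻ S i∈) (project-outside eq i))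

  preimage-convex : ∀ {C} → CycleConvex G C → CycleConvex H (preimage C)
  preimage-convex {C} C-convex u u∉ cycle =
    C-convex (embed u) (u∉ ∘ ∈-preimage⁺) (CycleThrough-embed (∈-preimage⁻ C) cycle)

  extend-convex : ∀ {C} → CycleConvex H C → CycleConvex G (extend true C)
  extend-convex {C} C-convex v v∉ cycle with project v in eq
  ... | nothing = v∉ (∈-extend-outside C eq)
  ... | just i with refl ← embed-project eq =
    C-convex i (v∉ ∘ ∈-extend⁺) (CycleThrough-unembed (∈-extend⁻ true C) cycle)

  InHull-unembed : ∀ {S i} → InHull G S (embed i) → InHull H (preimage S) i
  InHull-unembed {S} i∈⟨S⟩ C S⊆C C-convex =
    ∈-extend⁻ true C (i∈⟨S⟩ (extend true C) S⊆extend (extend-convex C-convex))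
    where
    S⊆extend : S ⊆ extend true C
    S⊆extend {v} v∈S with project v in eq
    ... | nothing = ∈-extend-outside C eq
    ... | just j with refl ← embed-project eq = ∈-extend⁺ (S⊆C (∈-preimage⁺ v∈S))

  InHull-embed : ∀ {S i} → InHull H (preimage S) i → InHull G S (embed i)
  InHull-embed {S} i∈⟨S⟩ C S⊆C C-convex =
    ∈-preimage⁻ C (i∈⟨S⟩ (preimage C) (∈-preimage⁺ ∘ S⊆C ∘ ∈-preimage⁻ S)
                          (preimage-convex C-convex))

  InRange : Subset (n G) → Set
  InRange S = ∀ {v} → v ∈ S → ∃ λ i → embed i ≡ v

  extend-false-inRange : ∀ S → InRange (extend false S)
  extend-false-inRange S {v} v∈
    with project v in eq | ∈-tabulate⁻ (maybe (lookup S) false ∘ project) v∈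
  ... | just i  | _ = i , embed-project eq
  ... | nothing | ()

  extend-preimage : ∀ {S} → InRange S → extend false (preimage S) ≡ S
  extend-preimage {S} S-in-range = trans (tabulate-cong agree) (tabulate∘lookup S)
    where
    agree : ∀ v → maybe (lookup (preimage S)) false (project v) ≡ lookup S v
    agree v with project v in eq
    ... | just i = trans (lookup∘tabulate (lookup S ∘ embed) i) (cong (lookup S) (embed-project eq))
    ... | nothing with lookup S v in v∈S
    ...   | false = refl
    ...   | true with S-in-range (lookup⇒[]= v S v∈S)
    ...     | i , refl = ⊥-elim (project-outside eq i refl)

  caratheodory-extend : ∀ {S} → CaratheodoryIndependent H S → CaratheodoryIndependent G (extend false S)
  caratheodory-extend {S} (p , p∈⟨S⟩ , minimal) =
    embed p , InHull-embed (InHull-mono H (∈-preimage⁺ ∘ ∈-extend⁺) p∈⟨S⟩) , minimal′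
    where
    minimal′ : ∀ a → a ∈ extend false S → ¬ InHull G (extend false S - a) (embed p)
    minimal′ a a∈ p∈⟨S-a⟩ with extend-false-inRange S a∈
    ... | j , refl = minimal j (∈-extend⁻ false S a∈) (InHull-mono H shrink (InHull-unembed p∈⟨S-a⟩))
      where
      shrink : preimage (extend false S - embed j) ⊆ S - j
      shrink i∈ = p⊆q⇒p-x⊆q-x (∈-extend⁻ false S ∘ ∈-preimage⁻ (extend false S))
                              (preimage-─⁻ (extend false S) i∈)

  -- A vertex of S off the range can be removed without losing the witness.
  CaratheodoryWitness-inRange : ∀ {S i} → CaratheodoryWitness G S (embed i) → InRange S
  CaratheodoryWitness-inRange {S} (i∈⟨S⟩ , minimal) {v} v∈S with project v in eq
  ... | just j  = j , embed-project eq
  ... | nothing = ⊥-elim (minimal v v∈S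
        (InHull-embed (InHull-mono H (preimage-─-outside S eq) (InHull-unembed i∈⟨S⟩))))

  caratheodory-preimage : ∀ {S i} → CaratheodoryWitness G S (embed i) →
                          CaratheodoryIndependent H (preimage S)
  caratheodory-preimage {S} {i} (i∈⟨S⟩ , minimal) =
    i , InHull-unembed i∈⟨S⟩ , λ a a∈ i∈⟨S-a⟩ →
      minimal (embed a) (∈-preimage⁻ S a∈) (InHull-embed (InHull-mono H (preimage-─⁺ S) i∈⟨S-a⟩))

  -- ∣ extend false S ∣ ≡ ∣ S ∣ holds for every component embedding; it is
  -- assumed here and checked directly for the two sides of a disjoint union.
  module _ (∣extend∣ : ∀ S → ∣ extend false S ∣ ≡ ∣ S ∣) {k} (car : IsCar H k) where

    caratheodory-extend-of-size : ∃ λ S → CaratheodoryIndependent G S × ∣ S ∣ ≡ k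
    caratheodory-extend-of-size =
      let (S , S-indep , ∣S∣≡k) = proj₁ car
      in extend false S , caratheodory-extend S-indep , trans (∣extend∣ S) ∣S∣≡k

    ∣CaratheodoryWitness∣≤car : ∀ {S i} → CaratheodoryWitness G S (embed i) → ∣ S ∣ ≤ k
    ∣CaratheodoryWitness∣≤car {S} w = begin
      ∣ S ∣                        ≡⟨ cong ∣_∣ (sym (extend-preimage (CaratheodoryWitness-inRange w))) ⟩
      ∣ extend false (preimage S) ∣ ≡⟨ ∣extend∣ (preimage S) ⟩
      ∣ preimage S ∣               ≤⟨ proj₂ car (preimage S) (caratheodory-preimage w) ⟩
      k                            ∎
      where open ℕ.≤-Reasoning

module _ (G₁ G₂ : Graph) where
  private
    n₁ = n G₁
    n₂ = n G₂
    adj∪ = ⊎adj (adj G₁) (adj G₂)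

  ↑ˡ-or-↑ʳ : ∀ v → (∃ λ i → i ↑ˡ n₂ ≡ v) ⊎ (∃ λ j → n₁ ↑ʳ j ≡ v)
  ↑ˡ-or-↑ʳ v with splitAt n₁ v in eq
  ... | inj₁ i = inj₁ (i , splitAt⁻¹-↑ˡ eq)
  ... | inj₂ j = inj₂ (j , splitAt⁻¹-↑ʳ eq)

  projectˡ : Fin (n₁ + n₂) → Maybe (Fin n₁)
  projectˡ = [ just , const nothing ]′ ∘ splitAt n₁

  projectʳ : Fin (n₁ + n₂) → Maybe (Fin n₂)
  projectʳ = [ const nothing , just ]′ ∘ splitAt n₁

  ↑ˡ-projectˡ : ∀ {v i} → projectˡ v ≡ just i → i ↑ˡ n₂ ≡ v
  ↑ˡ-projectˡ {v} eq with splitAt n₁ v in split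
  ↑ˡ-projectˡ refl | inj₁ _ = splitAt⁻¹-↑ˡ split

  ↑ʳ-projectʳ : ∀ {v j} → projectʳ v ≡ just j → n₁ ↑ʳ j ≡ v
  ↑ʳ-projectʳ {v} eq with splitAt n₁ v in split
  ↑ʳ-projectʳ refl | inj₂ _ = splitAt⁻¹-↑ʳ split

  ↑ˡ-adj-closed : ∀ x v → T (adj∪ (inj₁ x) (splitAt n₁ v)) → ∃ λ y → y ↑ˡ n₂ ≡ v
  ↑ˡ-adj-closed x v x~v with splitAt n₁ v in eq
  ... | inj₁ y = y , splitAt⁻¹-↑ˡ eq

  ↑ʳ-adj-closed : ∀ x v → T (adj∪ (inj₂ x) (splitAt n₁ v)) → ∃ λ y → n₁ ↑ʳ y ≡ v
  ↑ʳ-adj-closed x v x~v with splitAt n₁ v in eq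
  ... | inj₂ y = y , splitAt⁻¹-↑ʳ eq

  inj₁-embedding : ComponentEmbedding G₁ (G₁ ∪G G₂)
  inj₁-embedding = record
    { embed         = _↑ˡ n₂
    ; project       = projectˡ
    ; project-embed = λ i → cong [ just , const nothing ]′ (splitAt-↑ˡ n₁ i n₂)
    ; embed-project = ↑ˡ-projectˡ
    ; adj-embed     = λ x y → cong₂ adj∪ (splitAt-↑ˡ n₁ x n₂) (splitAt-↑ˡ n₁ y n₂)
    ; adj-closed    = λ x v → ↑ˡ-adj-closed x v
                        ∘ subst (λ s → T (adj∪ s (splitAt n₁ v))) (splitAt-↑ˡ n₁ x n₂)
    }

  inj₂-embedding : ComponentEmbedding G₂ (G₁ ∪G G₂)
  inj₂-embedding = record
    { embed         = n₁ ↑ʳ_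
    ; project       = projectʳ
    ; project-embed = λ j → cong [ const nothing , just ]′ (splitAt-↑ʳ n₁ n₂ j)
    ; embed-project = ↑ʳ-projectʳ
    ; adj-embed     = λ x y → cong₂ adj∪ (splitAt-↑ʳ n₁ n₂ x) (splitAt-↑ʳ n₁ n₂ y)
    ; adj-closed    = λ x v → ↑ʳ-adj-closed x v
                        ∘ subst (λ s → T (adj∪ s (splitAt n₁ v))) (splitAt-↑ʳ n₁ n₂ x)
    }

  extend-inj₁ : ∀ S → extend inj₁-embedding false S ≡ S ++ ∅
  extend-inj₁ S = trans (tabulate-cong agree) (tabulate∘lookup (S ++ ∅))
    where
    agree : ∀ v → maybe (lookup S) false (projectˡ v) ≡ lookup (S ++ ∅) v
    agree v with splitAt n₁ v | lookup-splitAt n₁ S ∅ v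
    ... | inj₁ i | eq = sym eq
    ... | inj₂ j | eq = sym (trans eq (lookup-replicate j false))

  extend-inj₂ : ∀ S → extend inj₂-embedding false S ≡ ∅ ++ S
  extend-inj₂ S = trans (tabulate-cong agree) (tabulate∘lookup (∅ ++ S))
    where
    agree : ∀ v → maybe (lookup S) false (projectʳ v) ≡ lookup (∅ ++ S) v
    agree v with splitAt n₁ v | lookup-splitAt n₁ ∅ S v
    ... | inj₁ i | eq = sym (trans eq (lookup-replicate i false))
    ... | inj₂ j | eq = sym eq

  ∣extend-inj₁∣ : ∀ S → ∣ extend inj₁-embedding false S ∣ ≡ ∣ S ∣
  ∣extend-inj₁∣ S = trans (cong ∣_∣ (extend-inj₁ S)) (∣p++∅∣≡∣p∣ S)

  ∣extend-inj₂∣ : ∀ S → ∣ extend inj₂-embedding false S ∣ ≡ ∣ S ∣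
  ∣extend-inj₂∣ S = trans (cong ∣_∣ (extend-inj₂ S)) (∣∅++p∣≡∣p∣ {n₁} S)

proposition4p2 : (G₁ G₂ : Graph) → 1 ≤ n G₁ → 1 ≤ n G₂ →
    (k₁ k₂ : ℕ) → IsCar G₁ k₁ → IsCar G₂ k₂ → IsCar (G₁ ∪G G₂) (k₁ ⊔ k₂)
proposition4p2 G₁ G₂ _ _ k₁ k₂ car₁ car₂ = lower , upper
  where
  ι₁ = inj₁-embedding G₁ G₂
  ι₂ = inj₂-embedding G₁ G₂

  lower : ∃ λ S → CaratheodoryIndependent (G₁ ∪G G₂) S × ∣ S ∣ ≡ k₁ ⊔ k₂
  lower with ℕ.≤-total k₁ k₂
  ... | inj₁ k₁≤k₂ rewrite ℕ.m≤n⇒m⊔n≡n k₁≤k₂ =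
    caratheodory-extend-of-size ι₂ (∣extend-inj₂∣ G₁ G₂) car₂
  ... | inj₂ k₂≤k₁ rewrite ℕ.m≥n⇒m⊔n≡m k₂≤k₁ =
    caratheodory-extend-of-size ι₁ (∣extend-inj₁∣ G₁ G₂) car₁

  upper : ∀ S → CaratheodoryIndependent (G₁ ∪G G₂) S → ∣ S ∣ ≤ k₁ ⊔ k₂
  upper S (p , w) with ↑ˡ-or-↑ʳ G₁ G₂ p
  ... | inj₁ (_ , refl) =
    ℕ.≤-trans (∣CaratheodoryWitness∣≤car ι₁ (∣extend-inj₁∣ G₁ G₂) car₁ w) (ℕ.m≤m⊔n k₁ k₂)
  ... | inj₂ (_ , refl) =
    ℕ.≤-trans (∣CaratheodoryWitness∣≤car ι₂ (∣extend-inj₂∣ G₁ G₂) car₂ w) (ℕ.m≤n⊔m k₁ k₂)
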